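{- Let $n\in\mathbb{N}$ and let $a,b,c,d$ be integers such that $\frac{a}{cn}$ and $\frac{b}{d}$ are positive real numbers with $|ad-bcn|=1$. Then every real $\alpha>0$ with $\min\{\frac{a}{cn},\frac{b}{d}\}\le\alpha\le\max\{\frac{a}{cn},\frac{b}{d}\}$ is not an infinite loop mod $n$.
   Context: For $\alpha>0$ with continued fraction expansion $[a_0;a_1,a_2,\ldots]$, the convergent denominators are $q_{ -1}=0$, $q_0=1$, $q_k=a_kq_{k-1}+q_{k-2}$, and the semi-convergent denominators are $q_{\{k,m\}}=mq_k+q_{k-1}$ for $k\ge0$ and integers $0\le m\le a_{k+1}$ (if $\alpha$ is rational with finite expansion $[a_0;\ldots,a_N]$, one regards $a_{N+1}=\infty$, so all integers $m\ge0$ are allowed at $k=N$). A real number $\alpha>0$ is an infinite loop mod $n$ if none of its semi-convergent denominators is divisible by $n$, apart from $q_{ -1}=0$. (Equivalently: the hyperbolic geodesic ray in the upper half-plane from the imaginary axis to $\alpha$ meets no edge $\phi\cdot I$, $\phi\in\Gamma_0(n)$, other than the edges $I+k$, $k\in\mathbb{Z}_{\ge0}$, where $I$ is the geodesic from $0$ to $\infty$ and $\Gamma_0(n)$ is the set of elements of $PSL_2(\mathbb{Z})$ whose lower-left entry is divisible by $n$, acting by Möbius transformations.) -}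

module Defs where

open import Data.Nat as ℕ using (ℕ; zero; suc; _≤_; _<_; _⊓_)
open import Data.Nat.Divisibility using (_∣_)
open import Data.Integer as ℤ using (ℤ; +_; -[1+_])
open import Data.Rational.Unnormalised as Q using (ℚᵘ; mkℚᵘ; 0ℚᵘ)
open import Data.Product using (Σ; _×_; _,_; proj₁; proj₂; ∃)
open import Data.Sum using (_⊎_)
open import Relation.Binary.PropositionalEquality using (_≡_; _≢_)
open import Relation.Nullary using (¬_)
open import Data.Unit using (⊤)

-- Positive real numbers, represented by their continued fraction
-- expansions  [a₀; a₁, a₂, …]  (a₀ ≥ 0, aₖ ≥ 1 for k ≥ 1).
-- Every real α > 0 has such an expansion: infinite iff α is irrational,
-- finite [a₀; …, a_N] iff α is rational.

data CF : Set where
  -- finite expansion [a 0; a 1, …, a N]  (values a k for k > N are ignored)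
  fin : (N : ℕ) (a : ℕ → ℕ) → CF
  inf : (a : ℕ → ℕ) → CF

ValidCF : CF → Set
ValidCF (fin N a) = ∀ k → 1 ≤ k → k ≤ N → 1 ≤ a k
ValidCF (inf a)   = ∀ k → 1 ≤ k → 1 ≤ a k

-- the represented real is > 0 (only fails for the finite expansion [0])
PositiveCF : CF → Set
PositiveCF (fin N a) = 1 ≤ N ⊎ 1 ≤ a 0
PositiveCF (inf a)   = ⊤

-- Convergents.
-- qq a k = (q_{k-1} , q_k) with q_{-1} = 0, q_0 = 1, q_k = a_k q_{k-1} + q_{k-2}
-- pp a k = (p_{k-1} , p_k) with p_{-1} = 1, p_0 = a_0, p_k = a_k p_{k-1} + p_{k-2}

qq : (ℕ → ℕ) → ℕ → ℕ × ℕ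
qq a zero    = 0 , 1
qq a (suc k) = proj₂ (qq a k) , a (suc k) ℕ.* proj₂ (qq a k) ℕ.+ proj₁ (qq a k)

pp : (ℕ → ℕ) → ℕ → ℕ × ℕ
pp a zero    = 1 , a 0
pp a (suc k) = proj₂ (pp a k) , a (suc k) ℕ.* proj₂ (pp a k) ℕ.+ proj₁ (pp a k)

q : (ℕ → ℕ) → ℕ → ℕ
q a k = proj₂ (qq a k)

qPrev : (ℕ → ℕ) → ℕ → ℕ
qPrev a k = proj₁ (qq a k)

p : (ℕ → ℕ) → ℕ → ℕ
p a k = proj₂ (pp a k)

-- the convergent p_k / q_k as a rational (q_k ≥ 1, so q_k = suc (q_k ∸ 1))
convAt : (ℕ → ℕ) → ℕ → ℚᵘ
convAt a k = mkℚᵘ (+ p a k) (q a k ℕ.∸ 1)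

-- the sequence of convergents of α; for a finite expansion it is
-- constant (= α) from index N on.  α is the limit of this sequence.
conv : CF → ℕ → ℚᵘ
conv (fin N a) k = convAt a (k ⊓ N)
conv (inf a)   k = convAt a k

-- Comparison of the real α = lim conv α with a rational r
-- (literal definition of "lim ≤ r" / "r ≤ lim" for a convergent sequence):
-- for every ε = 1/(M+1) > 0 the sequence is eventually ≤ r + ε (resp. ≥ r - ε).

_≤ℝ_ : CF → ℚᵘ → Set
α ≤ℝ r = ∀ (M : ℕ) → ∃ λ K → ∀ k → K ≤ k → conv α k Q.≤ r Q.+ mkℚᵘ (+ 1) M

_ℝ≤_ : ℚᵘ → CF → Set
r ℝ≤ α = ∀ (M : ℕ) → ∃ λ K → ∀ k → K ≤ k → r Q.- mkℚᵘ (+ 1) M Q.≤ conv α k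

-- The rational x / y for integers x, y with y ≠ 0 (junk value 0 for y = 0).

frac : ℤ → ℤ → ℚᵘ
frac x (+ zero)  = 0ℚᵘ
frac x (+ suc k) = mkℚᵘ x k
frac x -[1+ k ]  = mkℚᵘ (ℤ.- x) k

-- Semi-convergent denominators  q_{k,m} = m q_k + q_{k-1}, k ≥ 0,
-- 0 ≤ m ≤ a_{k+1}; for a finite expansion [a₀; …, a_N] one takes
-- a_{N+1} = ∞ (all m ≥ 0 allowed at k = N), and k ranges over 0 … N.

SemiConvDen : CF → ℕ → Set
SemiConvDen (fin N a) x =
  Σ ℕ λ k → Σ ℕ λ m → ((k < N × m ≤ a (suc k)) ⊎ k ≡ N) × x ≡ m ℕ.* q a k ℕ.+ qPrev a k
SemiConvDen (inf a) x =
  Σ ℕ λ k → Σ ℕ λ m → m ≤ a (suc k) × x ≡ m ℕ.* q a k ℕ.+ qPrev a k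

-- α is an infinite loop mod n: no semi-convergent denominator is divisible
-- by n, apart from q_{-1} = 0 (= q_{0,0}, the only semi-convergent
-- denominator equal to 0).
InfiniteLoop : ℕ → CF → Set
InfiniteLoop n α = ∀ x → SemiConvDen α x → x ≢ 0 → ¬ (n ∣ x)

module Submission where

-- Read fractions as vectors (numerator, denominator). Then A = a/(cn) and B = b/d satisfy
-- det(A, B) = ±1, so [A, B] is a Farey interval containing α. Descend the Stern–Brocot tree
-- along α: every interval met is spanned by a convergent U and a semi-convergent L of α, and
-- A, B have nonnegative coordinates in the unimodular basis (U, L). Unimodularity puts both
-- coordinate vectors on the same side of the diagonal unless {A, B} = {U, L}. On U's side the
-- interval is refined along α's path and the coordinates shrink. On L's side A and B lie in
-- [U + L, L], which the convergents of α eventually leave by a definite margin, contradicting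
-- α ∈ [A, B] -- except when α is the rational U + L itself, where A = U + L or
-- A = x(U + L) + L. In the remaining cases the denominator of A, divisible by n, is a
-- semi-convergent denominator, or (for A = x(U + L) + L) it yields one at the last index of α.

open import Data.Nat as ℕ using (ℕ; zero; suc; z≤n; s≤s; _≤_; _<_)
open import Data.Nat.Properties as ℕ using ()
open import Data.Integer as ℤ using (ℤ; +_; -[1+_]; +≤+; 0ℤ; 1ℤ; -1ℤ)
open import Data.Integer.Properties as ℤ using ()
import Data.Integer.Tactic.RingSolver as ℤ-Solver
import Data.Nat.Tactic.RingSolver as ℕ-Solver
open import Data.Product using (∃-syntax; _×_; _,_; proj₁; proj₂)
open import Data.Sum using (_⊎_; inj₁; inj₂)
import Data.Sum
open import Data.Unit using (⊤; tt)
open import Data.Bool using (true; false)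
open import Data.Rational.Unnormalised as Q using (mkℚᵘ; 0ℚᵘ)
open import Data.Empty using (⊥; ⊥-elim)
open import Relation.Nullary using (¬_)
open import Data.Nat.Divisibility using (_∣_; divides; ∣m+n∣m⇒∣n)
open import Relation.Binary.PropositionalEquality

open import Defs

IsUnit : ℤ → Set
IsUnit z = z ≡ 1ℤ ⊎ z ≡ -1ℤ

IsUnit-neg : ∀ {z} → IsUnit z → IsUnit (ℤ.- z)
IsUnit-neg (inj₁ refl) = inj₂ refl
IsUnit-neg (inj₂ refl) = inj₁ refl

IsUnit-pos : ∀ {k} → IsUnit (+ k) → k ≡ 1
IsUnit-pos (inj₁ refl) = refl

unit-cancel : ∀ {σ} → IsUnit σ → ∀ z → σ ℤ.* (z ℤ.* σ) ≡ z
unit-cancel (inj₁ refl) z = cancel z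
  where
  cancel : ∀ z → 1ℤ ℤ.* (z ℤ.* 1ℤ) ≡ z
  cancel = ℤ-Solver.solve-∀
unit-cancel (inj₂ refl) z = cancel z
  where
  cancel : ∀ z → -1ℤ ℤ.* (z ℤ.* -1ℤ) ≡ z
  cancel = ℤ-Solver.solve-∀

IsUnit-*-cancelʳ : ∀ {δ σ} → IsUnit σ → IsUnit (δ ℤ.* σ) → IsUnit δ
IsUnit-*-cancelʳ {δ} (inj₁ refl) u = subst IsUnit (ℤ.*-identityʳ δ) u
IsUnit-*-cancelʳ {δ} (inj₂ refl) u = subst IsUnit (neg-* δ) (IsUnit-neg u)
  where
  neg-* : ∀ d → ℤ.- (d ℤ.* -1ℤ) ≡ d
  neg-* = ℤ-Solver.solve-∀

0≤+ : ∀ k → 0ℤ ℤ.≤ + k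
0≤+ k = +≤+ z≤n

0≤* : ∀ {a b} → 0ℤ ℤ.≤ a → 0ℤ ℤ.≤ b → 0ℤ ℤ.≤ a ℤ.* b
0≤* {+ k} {+ l} _ _ = subst (0ℤ ℤ.≤_) (ℤ.pos-* k l) (+≤+ z≤n)

pos-suc-* : ∀ m n → + suc (m ℕ.* n) ≡ + m ℤ.* + n ℤ.+ 1ℤ
pos-suc-* m n = begin
  + suc (m ℕ.* n)          ≡⟨ cong +_ (ℕ.+-comm 1 (m ℕ.* n)) ⟩
  + (m ℕ.* n ℕ.+ 1)        ≡⟨ ℤ.pos-+ (m ℕ.* n) 1 ⟩
  + (m ℕ.* n) ℤ.+ 1ℤ       ≡⟨ cong (ℤ._+ 1ℤ) (ℤ.pos-* m n) ⟩
  + m ℤ.* + n ℤ.+ 1ℤ ∎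
  where open ≡-Reasoning

offset : ∀ {m n} → m ≤ n → ∃[ k ] n ≡ k ℕ.+ m
offset {m} {n} m≤n = n ℕ.∸ m , sym (ℕ.m∸n+n≡m m≤n)

ℕ² : Set
ℕ² = ℕ × ℕ

det : ℕ² → ℕ² → ℤ
det (x₁ , x₂) (y₁ , y₂) = + x₁ ℤ.* + y₂ ℤ.- + x₂ ℤ.* + y₁

comb : ℕ → ℕ² → ℕ → ℕ² → ℕ²
comb x (p₁ , p₂) y (q₁ , q₂) = x ℕ.* p₁ ℕ.+ y ℕ.* q₁ , x ℕ.* p₂ ℕ.+ y ℕ.* q₂

pos-comb : ∀ x p y q → + (x ℕ.* p ℕ.+ y ℕ.* q) ≡ + x ℤ.* + p ℤ.+ + y ℤ.* + q
pos-comb x p y q = trans (ℤ.pos-+ (x ℕ.* p) (y ℕ.* q)) (cong₂ ℤ._+_ (ℤ.pos-* x p) (ℤ.pos-* y q))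

det-comb : ∀ x y x′ y′ P Q →
           det (comb x P y Q) (comb x′ P y′ Q) ≡ det (x , y) (x′ , y′) ℤ.* det P Q
det-comb x y x′ y′ (p₁ , p₂) (q₁ , q₂) = begin
  det (comb x (p₁ , p₂) y (q₁ , q₂)) (comb x′ (p₁ , p₂) y′ (q₁ , q₂))
    ≡⟨ cong₂ ℤ._-_ (cong₂ ℤ._*_ (pos-comb x p₁ y q₁) (pos-comb x′ p₂ y′ q₂))
                   (cong₂ ℤ._*_ (pos-comb x p₂ y q₂) (pos-comb x′ p₁ y′ q₁)) ⟩
  (X ℤ.* P₁ ℤ.+ Y ℤ.* Q₁) ℤ.* (X′ ℤ.* P₂ ℤ.+ Y′ ℤ.* Q₂) ℤ.- (X ℤ.* P₂ ℤ.+ Y ℤ.* Q₂) ℤ.* (X′ ℤ.* P₁ ℤ.+ Y′ ℤ.* Q₁)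
    ≡⟨ expand X Y X′ Y′ P₁ P₂ Q₁ Q₂ ⟩
  (X ℤ.* Y′ ℤ.- Y ℤ.* X′) ℤ.* (P₁ ℤ.* Q₂ ℤ.- P₂ ℤ.* Q₁) ∎
  where
  open ≡-Reasoning
  X = + x; Y = + y; X′ = + x′; Y′ = + y′; P₁ = + p₁; P₂ = + p₂; Q₁ = + q₁; Q₂ = + q₂
  expand : ∀ x y x′ y′ p₁ p₂ q₁ q₂ →
    (x ℤ.* p₁ ℤ.+ y ℤ.* q₁) ℤ.* (x′ ℤ.* p₂ ℤ.+ y′ ℤ.* q₂) ℤ.- (x ℤ.* p₂ ℤ.+ y ℤ.* q₂) ℤ.* (x′ ℤ.* p₁ ℤ.+ y′ ℤ.* q₁)
    ≡ (x ℤ.* y′ ℤ.- y ℤ.* x′) ℤ.* (p₁ ℤ.* q₂ ℤ.- p₂ ℤ.* q₁)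
  expand = ℤ-Solver.solve-∀

det-antisym : ∀ X Y → det X Y ≡ ℤ.- det Y X
det-antisym (x₁ , x₂) (y₁ , y₂) = antisym (+ x₁) (+ x₂) (+ y₁) (+ y₂)
  where
  antisym : ∀ a b c d → a ℤ.* d ℤ.- b ℤ.* c ≡ ℤ.- (c ℤ.* b ℤ.- d ℤ.* a)
  antisym = ℤ-Solver.solve-∀

det-self : ∀ X → det X X ≡ 0ℤ
det-self (x₁ , x₂) = self (+ x₁) (+ x₂)
  where
  self : ∀ a b → a ℤ.* b ℤ.- b ℤ.* a ≡ 0ℤ
  self = ℤ-Solver.solve-∀

comb-identityˡ : ∀ P Q → comb 1 P 0 Q ≡ P
comb-identityˡ (p₁ , p₂) (q₁ , q₂) = cong₂ _,_ (unit p₁ q₁) (unit p₂ q₂)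
  where
  unit : ∀ p q → 1 ℕ.* p ℕ.+ 0 ℕ.* q ≡ p
  unit = ℕ-Solver.solve-∀

comb-identityʳ : ∀ P Q → comb 0 P 1 Q ≡ Q
comb-identityʳ (p₁ , p₂) (q₁ , q₂) = cong₂ _,_ (unit p₁ q₁) (unit p₂ q₂)
  where
  unit : ∀ p q → 0 ℕ.* p ℕ.+ 1 ℕ.* q ≡ q
  unit = ℕ-Solver.solve-∀

comb-comm : ∀ x P y Q → comb x P y Q ≡ comb y Q x P
comb-comm x (p₁ , p₂) y (q₁ , q₂) = cong₂ _,_ (ℕ.+-comm (x ℕ.* p₁) (y ℕ.* q₁)) (ℕ.+-comm (x ℕ.* p₂) (y ℕ.* q₂))

comb-comb : ∀ x α β y α′ β′ P Q →
            comb x (comb α P β Q) y (comb α′ P β′ Q) ≡ comb (x ℕ.* α ℕ.+ y ℕ.* α′) P (x ℕ.* β ℕ.+ y ℕ.* β′) Q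
comb-comb x α β y α′ β′ (p₁ , p₂) (q₁ , q₂) =
  cong₂ _,_ (expand x α β y α′ β′ p₁ q₁) (expand x α β y α′ β′ p₂ q₂)
  where
  expand : ∀ x α β y α′ β′ p q → x ℕ.* (α ℕ.* p ℕ.+ β ℕ.* q) ℕ.+ y ℕ.* (α′ ℕ.* p ℕ.+ β′ ℕ.* q)
                                 ≡ (x ℕ.* α ℕ.+ y ℕ.* α′) ℕ.* p ℕ.+ (x ℕ.* β ℕ.+ y ℕ.* β′) ℕ.* q
  expand = ℕ-Solver.solve-∀

comb-standard : ∀ x y → comb x (1 , 0) y (0 , 1) ≡ (x , y)
comb-standard x y = cong₂ _,_ (first x y) (second x y)
  where
  first : ∀ x y → x ℕ.* 1 ℕ.+ y ℕ.* 0 ≡ x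
  first = ℕ-Solver.solve-∀
  second : ∀ x y → x ℕ.* 0 ℕ.+ y ℕ.* 1 ≡ y
  second = ℕ-Solver.solve-∀

comb-shiftˡ : ∀ k y m P Q → comb (k ℕ.+ y) P y (comb m P 1 Q) ≡ comb k P y (comb (suc m) P 1 Q)
comb-shiftˡ k y m (p₁ , p₂) (q₁ , q₂) = cong₂ _,_ (shift k y m p₁ q₁) (shift k y m p₂ q₂)
  where
  shift : ∀ k y m p q → (k ℕ.+ y) ℕ.* p ℕ.+ y ℕ.* (m ℕ.* p ℕ.+ 1 ℕ.* q) ≡ k ℕ.* p ℕ.+ y ℕ.* (suc m ℕ.* p ℕ.+ 1 ℕ.* q)
  shift = ℕ-Solver.solve-∀

comb-shiftʳ : ∀ x k m P Q → comb x P (k ℕ.+ x) (comb m P 1 Q) ≡ comb x (comb (suc m) P 1 Q) k (comb m P 1 Q)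
comb-shiftʳ x k m (p₁ , p₂) (q₁ , q₂) = cong₂ _,_ (shift x k m p₁ q₁) (shift x k m p₂ q₂)
  where
  shift : ∀ x k m p q → x ℕ.* p ℕ.+ (k ℕ.+ x) ℕ.* (m ℕ.* p ℕ.+ 1 ℕ.* q)
                      ≡ x ℕ.* (suc m ℕ.* p ℕ.+ 1 ℕ.* q) ℕ.+ k ℕ.* (m ℕ.* p ℕ.+ 1 ℕ.* q)
  shift = ℕ-Solver.solve-∀

comb-split : ∀ e c P Q → comb (e ℕ.+ c) P 1 Q ≡ comb 1 (comb c P 1 Q) e P
comb-split e c (p₁ , p₂) (q₁ , q₂) = cong₂ _,_ (split e c p₁ q₁) (split e c p₂ q₂)
  where
  split : ∀ e c p q → (e ℕ.+ c) ℕ.* p ℕ.+ 1 ℕ.* q ≡ 1 ℕ.* (c ℕ.* p ℕ.+ 1 ℕ.* q) ℕ.+ e ℕ.* p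
  split = ℕ-Solver.solve-∀

comb-absorb : ∀ x y z P Q → comb x (comb 1 P y Q) z Q ≡ comb x P (x ℕ.* y ℕ.+ z) Q
comb-absorb x y z (p₁ , p₂) (q₁ , q₂) = cong₂ _,_ (absorb x y z p₁ q₁) (absorb x y z p₂ q₂)
  where
  absorb : ∀ x y z p q → x ℕ.* (1 ℕ.* p ℕ.+ y ℕ.* q) ℕ.+ z ℕ.* q ≡ x ℕ.* p ℕ.+ (x ℕ.* y ℕ.+ z) ℕ.* q
  absorb = ℕ-Solver.solve-∀

comb-denominator-≤ : ∀ μ ν w P Q → μ ≤ w → ν ≤ w → proj₂ (comb μ P ν Q) ≤ (proj₂ P ℕ.+ proj₂ Q) ℕ.* w
comb-denominator-≤ μ ν w (_ , p) (_ , q) μ≤w ν≤w = begin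
  μ ℕ.* p ℕ.+ ν ℕ.* q   ≤⟨ ℕ.+-mono-≤ (ℕ.*-monoˡ-≤ p μ≤w) (ℕ.*-monoˡ-≤ q ν≤w) ⟩
  w ℕ.* p ℕ.+ w ℕ.* q   ≡⟨ trans (sym (ℕ.*-distribˡ-+ w p q)) (ℕ.*-comm w (p ℕ.+ q)) ⟩
  (p ℕ.+ q) ℕ.* w ∎
  where open ℕ.≤-Reasoning

det-combʳ : ∀ x y P Q → det P (comb x P y Q) ≡ + y ℤ.* det P Q
det-combʳ x y P Q = begin
  det P (comb x P y Q)                     ≡⟨ cong (λ X → det X (comb x P y Q)) (comb-identityˡ P Q) ⟨
  det (comb 1 P 0 Q) (comb x P y Q)        ≡⟨ det-comb 1 0 x y P Q ⟩
  (1ℤ ℤ.* + y ℤ.- 0ℤ ℤ.* + x) ℤ.* det P Q ≡⟨ cong (ℤ._* det P Q) (coefficient (+ x) (+ y)) ⟩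
  + y ℤ.* det P Q ∎
  where
  open ≡-Reasoning
  coefficient : ∀ x y → 1ℤ ℤ.* y ℤ.- 0ℤ ℤ.* x ≡ y
  coefficient = ℤ-Solver.solve-∀

det-combˡ : ∀ x y P Q → det (comb x P y Q) P ≡ ℤ.- + y ℤ.* det P Q
det-combˡ x y P Q = begin
  det (comb x P y Q) P          ≡⟨ det-antisym (comb x P y Q) P ⟩
  ℤ.- det P (comb x P y Q)      ≡⟨ cong ℤ.-_ (det-combʳ x y P Q) ⟩
  ℤ.- (+ y ℤ.* det P Q)         ≡⟨ ℤ.neg-distribˡ-* (+ y) (det P Q) ⟩
  ℤ.- + y ℤ.* det P Q ∎
  where open ≡-Reasoning

det-comb-succ : ∀ m P Q → det (comb (suc m) P 1 Q) (comb m P 1 Q) ≡ det P Q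
det-comb-succ m P Q = begin
  det (comb (suc m) P 1 Q) (comb m P 1 Q)        ≡⟨ det-comb (suc m) 1 m 1 P Q ⟩
  (+ suc m ℤ.* 1ℤ ℤ.- 1ℤ ℤ.* + m) ℤ.* det P Q    ≡⟨ cong (λ k → (k ℤ.* 1ℤ ℤ.- 1ℤ ℤ.* + m) ℤ.* det P Q) (ℤ.pos-+ 1 m) ⟩
  ((1ℤ ℤ.+ + m) ℤ.* 1ℤ ℤ.- 1ℤ ℤ.* + m) ℤ.* det P Q ≡⟨ coefficient (+ m) (det P Q) ⟩
  det P Q ∎
  where
  open ≡-Reasoning
  coefficient : ∀ m d → ((1ℤ ℤ.+ m) ℤ.* 1ℤ ℤ.- 1ℤ ℤ.* m) ℤ.* d ≡ d
  coefficient = ℤ-Solver.solve-∀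

det-excess : ∀ x y x′ y′ k → x ℕ.* y′ ≡ y ℕ.* x′ ℕ.+ k → det (x , y) (x′ , y′) ≡ + k
det-excess x y x′ y′ k eq = begin
  + x ℤ.* + y′ ℤ.- + y ℤ.* + x′   ≡⟨ cong₂ ℤ._-_ (ℤ.pos-* x y′) (ℤ.pos-* y x′) ⟨
  + (x ℕ.* y′) ℤ.- + (y ℕ.* x′)   ≡⟨ cong (λ t → + t ℤ.- + (y ℕ.* x′)) eq ⟩
  + (y ℕ.* x′ ℕ.+ k) ℤ.- + (y ℕ.* x′) ≡⟨ cong (ℤ._- + (y ℕ.* x′)) (ℤ.pos-+ (y ℕ.* x′) k) ⟩
  + (y ℕ.* x′) ℤ.+ + k ℤ.- + (y ℕ.* x′) ≡⟨ cancel (+ (y ℕ.* x′)) (+ k) ⟩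
  + k ∎
  where
  open ≡-Reasoning
  cancel : ∀ a b → a ℤ.+ b ℤ.- a ≡ b
  cancel = ℤ-Solver.solve-∀

det-transpose-swap : ∀ x y x′ y′ → det (y , x) (y′ , x′) ≡ ℤ.- det (x , y) (x′ , y′)
det-transpose-swap x y x′ y′ = swap (+ x) (+ y) (+ x′) (+ y′)
  where
  swap : ∀ a b c d → b ℤ.* c ℤ.- a ℤ.* d ≡ ℤ.- (a ℤ.* d ℤ.- b ℤ.* c)
  swap = ℤ-Solver.solve-∀

unit-first-row : ∀ x x′ y′ → IsUnit (det (x , 0) (x′ , y′)) → x ≡ 1
unit-first-row x x′ y′ unit = ℕ.m*n≡1⇒m≡1 x y′ (IsUnit-pos (subst IsUnit value unit))
  where
  value : det (x , 0) (x′ , y′) ≡ + (x ℕ.* y′)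
  value = trans (ℤ.+-identityʳ (+ x ℤ.* + y′)) (sym (ℤ.pos-* x y′))

unit-second-row : ∀ x y x′ → IsUnit (det (x , y) (x′ , 0)) → y ≡ 1
unit-second-row x y x′ unit = ℕ.m*n≡1⇒m≡1 y x′ (IsUnit-pos (subst IsUnit value (IsUnit-neg unit)))
  where
  value : ℤ.- det (x , y) (x′ , 0) ≡ + (y ℕ.* x′)
  value = begin
    ℤ.- (+ x ℤ.* 0ℤ ℤ.- + y ℤ.* + x′)  ≡⟨ cong (λ v → ℤ.- (v ℤ.- + y ℤ.* + x′)) (ℤ.*-zeroʳ (+ x)) ⟩
    ℤ.- (0ℤ ℤ.- + y ℤ.* + x′)          ≡⟨ cong ℤ.-_ (ℤ.+-identityˡ (ℤ.- (+ y ℤ.* + x′))) ⟩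
    ℤ.- ℤ.- (+ y ℤ.* + x′)             ≡⟨ ℤ.neg-involutive (+ y ℤ.* + x′) ⟩
    + y ℤ.* + x′                        ≡⟨ ℤ.pos-* y x′ ⟨
    + (y ℕ.* x′) ∎
    where open ≡-Reasoning

unit-second-column : ∀ x y x′ y′ → IsUnit (det (x , y) (x′ , y′)) → 1 ≤ y ℕ.+ y′
unit-second-column x zero    x′ zero     unit with subst IsUnit (cong (ℤ._- 0ℤ) (ℤ.*-zeroʳ (+ x))) unit
... | inj₁ ()
... | inj₂ ()
unit-second-column x zero    x′ (suc y′) _ = s≤s z≤n
unit-second-column x (suc y) x′ y′       _ = s≤s z≤n

data UnimodularShape : ℕ → ℕ → ℕ → ℕ → Set where
  first-dominates  : ∀ k y k′ y′ → UnimodularShape (k ℕ.+ y) y (k′ ℕ.+ y′) y′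
  second-dominates : ∀ x k x′ k′ → UnimodularShape x (k ℕ.+ x) x′ (k′ ℕ.+ x′)
  standard         : UnimodularShape 1 0 0 1
  swapped          : UnimodularShape 0 1 1 0

crossing-product : ∀ y a x′ b → (a ℕ.+ suc y) ℕ.* (b ℕ.+ suc x′)
  ≡ y ℕ.* x′ ℕ.+ suc (y ℕ.+ a ℕ.+ x′ ℕ.+ b ℕ.+ (y ℕ.* b ℕ.+ a ℕ.* x′ ℕ.+ a ℕ.* b))
crossing-product = ℕ-Solver.solve-∀

no-crossing : ∀ y a x′ b → IsUnit (det (a ℕ.+ suc y , y) (x′ , b ℕ.+ suc x′)) →
              y ≡ 0 × a ≡ 0 × x′ ≡ 0 × b ≡ 0
no-crossing y a x′ b u
  with ℕ.suc-injective (IsUnit-pos (subst IsUnit (det-excess (a ℕ.+ suc y) y x′ (b ℕ.+ suc x′) _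
                                                              (crossing-product y a x′ b)) u))
no-crossing zero zero zero zero u | _ = refl , refl , refl , refl

first-dominates′ : ∀ {x y x′ y′} → y ≤ x → y′ ≤ x′ → UnimodularShape x y x′ y′
first-dominates′ y≤x y′≤x′ with offset y≤x | offset y′≤x′
... | k , refl | k′ , refl = first-dominates k _ k′ _

second-dominates′ : ∀ {x y x′ y′} → x ≤ y → x′ ≤ y′ → UnimodularShape x y x′ y′
second-dominates′ x≤y x′≤y′ with offset x≤y | offset x′≤y′
... | k , refl | k′ , refl = second-dominates _ k _ k′

unimodular-shape : ∀ x y x′ y′ → IsUnit (det (x , y) (x′ , y′)) → UnimodularShape x y x′ y′
unimodular-shape x y x′ y′ u with ℕ.≤-total y x | ℕ.≤-total y′ x′
... | inj₁ y≤x | inj₁ y′≤x′ = first-dominates′ y≤x y′≤x′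
... | inj₂ x≤y | inj₂ x′≤y′ = second-dominates′ x≤y x′≤y′
... | inj₁ y≤x | inj₂ x′≤y′ with ℕ.m≤n⇒m<n∨m≡n y≤x | ℕ.m≤n⇒m<n∨m≡n x′≤y′
...   | inj₂ refl | _         = second-dominates′ ℕ.≤-refl x′≤y′
...   | inj₁ _    | inj₂ refl = first-dominates′ y≤x ℕ.≤-refl
...   | inj₁ y<x  | inj₁ x′<y′ with offset y<x | offset x′<y′
...     | a , refl | b , refl with no-crossing y a x′ b u
...       | refl , refl , refl , refl = standard
unimodular-shape x y x′ y′ u | inj₂ x≤y | inj₁ y′≤x′ with ℕ.m≤n⇒m<n∨m≡n x≤y | ℕ.m≤n⇒m<n∨m≡n y′≤x′
...   | inj₂ refl | _         = first-dominates′ ℕ.≤-refl y′≤x′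
...   | inj₁ _    | inj₂ refl = second-dominates′ x≤y ℕ.≤-refl
...   | inj₁ x<y  | inj₁ y′<x′ with offset x<y | offset y′<x′
...     | a , refl | b , refl
        with no-crossing x a y′ b (subst IsUnit (sym (det-transpose-swap x (a ℕ.+ suc x) (b ℕ.+ suc y′) y′)) (IsUnit-neg u))
...       | refl , refl , refl , refl = swapped

-- pq a k = (p_{k-2}, q_{k-2}); in particular pq a 0 = (0, 1) and pq a 1 = (1, 0).
pq : (ℕ → ℕ) → ℕ → ℕ²
pq a zero    = 0 , 1
pq a (suc k) = proj₁ (pp a k) , proj₁ (qq a k)

pq-step : ∀ a k → pq a (suc (suc k)) ≡ comb (a k) (pq a (suc k)) 1 (pq a k)
pq-step a zero    = cong₂ _,_ (numerator (a 0)) (denominator (a 0))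
  where
  numerator : ∀ c → c ≡ c ℕ.* 1 ℕ.+ 1 ℕ.* 0
  numerator = ℕ-Solver.solve-∀
  denominator : ∀ c → 1 ≡ c ℕ.* 0 ℕ.+ 1 ℕ.* 1
  denominator = ℕ-Solver.solve-∀
pq-step a (suc k) = cong₂ _,_ (cong (a (suc k) ℕ.* p a k ℕ.+_) (sym (ℕ.*-identityˡ _)))
                              (cong (a (suc k) ℕ.* q a k ℕ.+_) (sym (ℕ.*-identityˡ _)))

det-pq-step : ∀ a k → det (pq a (suc (suc k))) (pq a (suc k)) ≡ ℤ.- det (pq a (suc k)) (pq a k)
det-pq-step a k = begin
  det (pq a (suc (suc k))) P     ≡⟨ cong (λ X → det X P) (pq-step a k) ⟩
  det (comb (a k) P 1 Q) P       ≡⟨ det-combˡ (a k) 1 P Q ⟩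
  -1ℤ ℤ.* det P Q                ≡⟨ ℤ.-1*i≡-i (det P Q) ⟩
  ℤ.- det P Q ∎
  where
  open ≡-Reasoning
  P = pq a (suc k)
  Q = pq a k

det-pq : ∀ a k → IsUnit (det (pq a (suc k)) (pq a k))
det-pq a zero    = inj₁ refl
det-pq a (suc k) = subst IsUnit (sym (det-pq-step a k)) (IsUnit-neg (det-pq a k))

q-positive : ∀ a k → (∀ i → 1 ≤ i → i ≤ k → 1 ≤ a i) → 1 ≤ q a k
q-positive a zero    _   = ℕ.≤-refl
q-positive a (suc k) a≥1 =
  ℕ.≤-trans (ℕ.*-mono-≤ (a≥1 (suc k) (s≤s z≤n) ℕ.≤-refl) (q-positive a k (λ i 1≤i i≤k → a≥1 i 1≤i (ℕ.m≤n⇒m≤1+n i≤k))))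
            (ℕ.m≤m+n _ _)

Dominant : ℕ² → ℕ² → ℕ² → Set
Dominant P Q X = ∃[ μ ] ∃[ ν ] X ≡ comb μ P ν Q × 1 ≤ μ × ν ≤ μ

dominant-self : ∀ P Q → Dominant P Q P
dominant-self P Q = 1 , 0 , sym (comb-identityˡ P Q) , ℕ.≤-refl , z≤n

dominant-step : ∀ {P Q X Y} c → 1 ≤ c → Dominant P Q X → Dominant P Q Y → Dominant P Q (comb c Y 1 X)
dominant-step {P} {Q} c 1≤c (μ , ν , refl , 1≤μ , ν≤μ) (μ′ , ν′ , refl , 1≤μ′ , ν′≤μ′) =
  c ℕ.* μ′ ℕ.+ 1 ℕ.* μ , c ℕ.* ν′ ℕ.+ 1 ℕ.* ν ,
  comb-comb c μ′ ν′ 1 μ ν P Q ,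
  ℕ.≤-trans (ℕ.*-mono-≤ 1≤c 1≤μ′) (ℕ.m≤m+n _ _) ,
  ℕ.+-mono-≤ (ℕ.*-monoʳ-≤ c ν′≤μ′) (ℕ.*-monoʳ-≤ 1 ν≤μ)

pq-tail : ∀ a {j i} → j ≤ i → (∀ e → j < e → e ≤ i → 1 ≤ a e) →
          Dominant (pq a (suc (suc j))) (pq a (suc j)) (pq a (suc (suc i)))
pq-tail a {j} j≤i partial-quotients with offset j≤i
... | zero  , refl = dominant-self _ _
... | suc d , refl = proj₂ (consecutive d partial-quotients)
  where
  P = pq a (suc (suc j))
  Q = pq a (suc j)
  consecutive : ∀ d → (∀ e → j < e → e ≤ suc d ℕ.+ j → 1 ≤ a e) →
                Dominant P Q (pq a (suc (suc (d ℕ.+ j)))) × Dominant P Q (pq a (suc (suc (suc d ℕ.+ j))))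
  consecutive zero    a≥1 = dominant-self P Q ,
                            (a (suc j) , 1 , pq-step a (suc j) , 1≤a , 1≤a)
    where
    1≤a = a≥1 (suc j) ℕ.≤-refl ℕ.≤-refl
  consecutive (suc d) a≥1 with consecutive d (λ e j<e e≤ → a≥1 e j<e (ℕ.m≤n⇒m≤1+n e≤))
  ... | X , Y = Y , subst (Dominant P Q) (sym (pq-step a (suc (suc d ℕ.+ j))))
                          (dominant-step _ (a≥1 _ (s≤s (ℕ.m≤n+m j (suc d))) ℕ.≤-refl) X Y)

coeffs : CF → ℕ → ℕ
coeffs (fin N a) = a
coeffs (inf a)   = a

InRange : CF → ℕ → Set
InRange (fin N a) i = i ≤ N
InRange (inf a)   i = ⊤

PastEnd : CF → ℕ → Set
PastEnd (fin N a) j = j ≡ suc N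
PastEnd (inf a)   j = ⊥

inRange-zero : ∀ α → InRange α 0
inRange-zero (fin N a) = z≤n
inRange-zero (inf a)   = tt

inRange-≤ : ∀ α {i j} → i ≤ j → InRange α j → InRange α i
inRange-≤ (fin N a) i≤j j≤N = ℕ.≤-trans i≤j j≤N
inRange-≤ (inf a)   _   _   = tt

inRange-suc : ∀ α {j} → InRange α j → InRange α (suc j) ⊎ PastEnd α (suc j)
inRange-suc (fin N a) j≤N = Data.Sum.map₂ (cong suc) (ℕ.m≤n⇒m<n∨m≡n j≤N)
inRange-suc (inf a)   _   = inj₁ tt

pastEnd-pred : ∀ α {k} → PastEnd α (suc k) → InRange α k
pastEnd-pred (fin N a) refl = ℕ.≤-refl

inRange-pastEnd : ∀ α {j} → InRange α j → ¬ PastEnd α j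
inRange-pastEnd (fin N a) j≤N refl = ℕ.<-irrefl refl j≤N

coeff-positive : ∀ α → ValidCF α → ∀ {i} → 1 ≤ i → InRange α i → 1 ≤ coeffs α i
coeff-positive (fin N a) valid 1≤i i≤N = valid _ 1≤i i≤N
coeff-positive (inf a)   valid 1≤i _   = valid _ 1≤i

conv-tail : ∀ α {j} → InRange α j →
            ∃[ K ] ∀ i → K ≤ i → ∃[ k ] j ≤ k × InRange α k × conv α i ≡ convAt (coeffs α) k
conv-tail (fin N a) {j} j≤N = j , λ i j≤i → i ℕ.⊓ N , ℕ.⊓-glb j≤i j≤N , ℕ.m⊓n≤n i N , refl
conv-tail (inf a)   {j} _   = j , λ i j≤i → i , j≤i , tt , refl

conv-pastEnd : ∀ α {k} → PastEnd α (suc k) → ∀ i → k ≤ i → conv α i ≡ convAt (coeffs α) k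
conv-pastEnd (fin N a) refl i N≤i = cong (convAt a) (ℕ.m≥n⇒m⊓n≡n N≤i)

Admissible : CF → ℕ → ℕ → Set
Admissible α j m = (InRange α j × m ≤ coeffs α j) ⊎ PastEnd α j

semiConvDen : ∀ α {k m} → Admissible α (suc k) m → SemiConvDen α (m ℕ.* q (coeffs α) k ℕ.+ qPrev (coeffs α) k)
semiConvDen (fin N a) {k} {m} (inj₁ k<N,m≤) = k , m , inj₁ k<N,m≤ , refl
semiConvDen (fin N a) {k} {m} (inj₂ refl)   = k , m , inj₂ refl , refl
semiConvDen (inf a)   {k} {m} (inj₁ (_ , m≤)) = k , m , m≤ , refl

admissible-pred : ∀ α {j m} → Admissible α j (suc m) → Admissible α j m
admissible-pred α (inj₁ (j∈ , m<a)) = inj₁ (j∈ , ℕ.<⇒≤ m<a)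
admissible-pred α (inj₂ end)        = inj₂ end

admissible-start : ∀ α → ValidCF α → ∀ {j} → InRange α j → Admissible α (suc j) 1
admissible-start α valid j∈ with inRange-suc α j∈
... | inj₁ sj∈ = inj₁ (sj∈ , coeff-positive α valid (s≤s z≤n) sj∈)
... | inj₂ end = inj₂ end

convergentDen : ∀ α → ValidCF α → ∀ {k} → InRange α k → SemiConvDen α (q (coeffs α) k)
convergentDen α valid {zero}  _  = semiConvDen α (admissible-start α valid (inRange-zero α))
convergentDen α valid {suc k} k∈ = semiConvDen α (inj₁ (k∈ , ℕ.≤-refl))

divisible-at-end : ∀ α {k} → PastEnd α (suc k) → 1 ≤ q (coeffs α) k →
                   ∀ n {d c} → d ℕ.+ qPrev (coeffs α) k ≡ c ℕ.* q (coeffs α) k → suc n ∣ d →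
                   ∃[ x ] SemiConvDen α x × x ≢ 0 × suc n ∣ x
divisible-at-end α {k} end 1≤qₖ n {d} {c} d+qₖ₋₁≡cqₖ n∣d =
  x , semiConvDen α {m = m} (inj₂ end) , x≢0 , ∣m+n∣m⇒∣n (divides (suc c ℕ.* qₖ) sum) n∣d
  where
  qₖ = q (coeffs α) k
  qₖ₋₁ = qPrev (coeffs α) k
  m = n ℕ.* c ℕ.+ suc n    -- m ≡ −c (mod n + 1), making d + x a multiple of n + 1
  x = m ℕ.* qₖ ℕ.+ qₖ₋₁
  sum : d ℕ.+ x ≡ suc c ℕ.* qₖ ℕ.* suc n
  sum = begin
    d ℕ.+ (m ℕ.* qₖ ℕ.+ qₖ₋₁)   ≡⟨ exchange d (m ℕ.* qₖ) qₖ₋₁ ⟩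
    m ℕ.* qₖ ℕ.+ (d ℕ.+ qₖ₋₁)   ≡⟨ cong (m ℕ.* qₖ ℕ.+_) d+qₖ₋₁≡cqₖ ⟩
    m ℕ.* qₖ ℕ.+ c ℕ.* qₖ       ≡⟨ collect n c qₖ ⟩
    suc c ℕ.* qₖ ℕ.* suc n ∎
    where
    open ≡-Reasoning
    exchange : ∀ a b c → a ℕ.+ (b ℕ.+ c) ≡ b ℕ.+ (a ℕ.+ c)
    exchange = ℕ-Solver.solve-∀
    collect : ∀ n c q → (n ℕ.* c ℕ.+ suc n) ℕ.* q ℕ.+ c ℕ.* q ≡ suc c ℕ.* q ℕ.* suc n
    collect = ℕ-Solver.solve-∀
  1≤m : 1 ≤ m
  1≤m = ℕ.≤-trans (s≤s z≤n) (ℕ.m≤n+m (suc n) (n ℕ.* c))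
  x≢0 : x ≢ 0
  x≢0 x≡0 = ℕ.<-irrefl (sym x≡0) (ℕ.≤-trans (ℕ.*-mono-≤ 1≤m 1≤qₖ) (ℕ.m≤m+n _ qₖ₋₁))

-- If c₁/c₂ ≥ e₁/e₂ + 1/(g e₂) and x₁/x₂ ≤ e₁/e₂ then c₁/c₂ ≤ x₁/x₂ + 1/(e₂ g + 1) is impossible;
-- the cleared-denominator form is the identity below, whose left side is positive.
no-room : ∀ e₁ e₂ x₁ x₂ c₁ c₂ g m → 0ℤ ℤ.≤ e₂ → 0ℤ ℤ.≤ g → m ≡ e₂ ℤ.* g ℤ.+ 1ℤ →
          0ℤ ℤ.≤ e₁ ℤ.* + suc x₂ ℤ.- e₂ ℤ.* x₁ →
          g ℤ.* (e₁ ℤ.* + suc c₂ ℤ.- e₂ ℤ.* c₁) ℤ.≤ ℤ.- + suc c₂ →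
          c₁ ℤ.* (+ suc x₂ ℤ.* m) ℤ.≤ (x₁ ℤ.* m ℤ.+ + suc x₂) ℤ.* + suc c₂ → ⊥
no-room e₁ e₂ x₁ x₂ c₁ c₂ g m 0≤e₂ 0≤g refl 0≤P₁ E<C C≤X+ε with subst (1ℤ ℤ.≤_) vanishes positive
  where
  X₂ = + suc x₂
  C₂ = + suc c₂
  P₁ = e₁ ℤ.* X₂ ℤ.- e₂ ℤ.* x₁
  P₂ = ℤ.- C₂ ℤ.- g ℤ.* (e₁ ℤ.* C₂ ℤ.- e₂ ℤ.* c₁)
  P₃ = (x₁ ℤ.* m ℤ.+ X₂) ℤ.* C₂ ℤ.- c₁ ℤ.* (X₂ ℤ.* m)
  S = X₂ ℤ.* P₂ ℤ.+ (C₂ ℤ.* g) ℤ.* P₁ ℤ.+ (g ℤ.* e₂) ℤ.* (P₃ ℤ.+ X₂ ℤ.* P₂ ℤ.+ (C₂ ℤ.* g) ℤ.* P₁)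
  0≤S : 0ℤ ℤ.≤ S
  0≤S = ℤ.+-mono-≤ (ℤ.+-mono-≤ (0≤* (0≤+ (suc x₂)) 0≤P₂) (0≤* (0≤* (0≤+ (suc c₂)) 0≤g) 0≤P₁))
            (0≤* (0≤* 0≤g 0≤e₂) (ℤ.+-mono-≤ (ℤ.+-mono-≤ 0≤P₃ (0≤* (0≤+ (suc x₂)) 0≤P₂)) (0≤* (0≤* (0≤+ (suc c₂)) 0≤g) 0≤P₁)))
    where
    0≤P₂ : 0ℤ ℤ.≤ P₂
    0≤P₂ = ℤ.i≤j⇒0≤j-i E<C
    0≤P₃ : 0ℤ ℤ.≤ P₃
    0≤P₃ = ℤ.i≤j⇒0≤j-i C≤X+ε
  positive : 1ℤ ℤ.≤ X₂ ℤ.* C₂ ℤ.+ S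
  positive = ℤ.+-mono-≤ (+≤+ (s≤s z≤n)) 0≤S
  vanishes : X₂ ℤ.* C₂ ℤ.+ S ≡ 0ℤ
  vanishes = identity e₁ e₂ x₁ X₂ c₁ C₂ g
    where
    identity : ∀ e₁ e₂ x₁ x₂ c₁ c₂ g →
      x₂ ℤ.* c₂ ℤ.+ (x₂ ℤ.* (ℤ.- c₂ ℤ.- g ℤ.* (e₁ ℤ.* c₂ ℤ.- e₂ ℤ.* c₁)) ℤ.+ (c₂ ℤ.* g) ℤ.* (e₁ ℤ.* x₂ ℤ.- e₂ ℤ.* x₁)
        ℤ.+ (g ℤ.* e₂) ℤ.* ((x₁ ℤ.* (e₂ ℤ.* g ℤ.+ 1ℤ) ℤ.+ x₂) ℤ.* c₂ ℤ.- c₁ ℤ.* (x₂ ℤ.* (e₂ ℤ.* g ℤ.+ 1ℤ))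
          ℤ.+ x₂ ℤ.* (ℤ.- c₂ ℤ.- g ℤ.* (e₁ ℤ.* c₂ ℤ.- e₂ ℤ.* c₁)) ℤ.+ (c₂ ℤ.* g) ℤ.* (e₁ ℤ.* x₂ ℤ.- e₂ ℤ.* x₁)))
      ≡ 0ℤ
    identity = ℤ-Solver.solve-∀
... | +≤+ ()

⊔-selective : ∀ x₁ x₂ y₁ y₂ → let X = mkℚᵘ x₁ x₂; Y = mkℚᵘ y₁ y₂ in X Q.⊔ Y ≡ X ⊎ X Q.⊔ Y ≡ Y
⊔-selective x₁ x₂ y₁ y₂ with mkℚᵘ x₁ x₂ Q.≤ᵇ mkℚᵘ y₁ y₂
... | true  = inj₂ refl
... | false = inj₁ refl

⊓-selective : ∀ x₁ x₂ y₁ y₂ → let X = mkℚᵘ x₁ x₂; Y = mkℚᵘ y₁ y₂ in X Q.⊓ Y ≡ X ⊎ X Q.⊓ Y ≡ Y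
⊓-selective x₁ x₂ y₁ y₂ with mkℚᵘ x₁ x₂ Q.≤ᵇ mkℚᵘ y₁ y₂
... | true  = inj₁ refl
... | false = inj₂ refl

module Separation (α : CF) (r s t u : ℕ)
  (lower : (mkℚᵘ (+ r) s Q.⊓ mkℚᵘ (+ t) u) ℝ≤ α)
  (upper : α ≤ℝ (mkℚᵘ (+ r) s Q.⊔ mkℚᵘ (+ t) u)) where

  A B : ℕ²
  A = r , suc s
  B = t , suc u

  -- Reading vectors as fractions, all late convergents C of α satisfy σ (E − C) ≤ −1/(g e₂).
  EventuallyBeyond : ℕ² → ℤ → Set
  EventuallyBeyond E σ = ∃[ g ] ∃[ K ] ∀ i → K ≤ i → ∃[ c₁ ] ∃[ c₂ ]
    conv α i ≡ mkℚᵘ (+ c₁) c₂ × + g ℤ.* (σ ℤ.* det E (c₁ , suc c₂)) ℤ.≤ ℤ.- + suc c₂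

  private
    above : ∀ e₁ e₂ x₁ x₂ c₁ c₂ g → 0ℤ ℤ.≤ 1ℤ ℤ.* det (e₁ , e₂) (x₁ , suc x₂) →
            + g ℤ.* (1ℤ ℤ.* det (e₁ , e₂) (c₁ , suc c₂)) ℤ.≤ ℤ.- + suc c₂ →
            ¬ (mkℚᵘ (+ c₁) c₂ Q.≤ mkℚᵘ (+ x₁) x₂ Q.+ mkℚᵘ 1ℤ (e₂ ℕ.* g))
    above e₁ e₂ x₁ x₂ c₁ c₂ g X≤E E<C (Q.*≤* C≤X+ε) =
      no-room (+ e₁) (+ e₂) (+ x₁) x₂ (+ c₁) c₂ (+ g) (+ suc (e₂ ℕ.* g)) (0≤+ e₂) (0≤+ g) (pos-suc-* e₂ g)
              (subst (0ℤ ℤ.≤_) (ℤ.*-identityˡ _) X≤E)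
              (subst (λ v → + g ℤ.* v ℤ.≤ ℤ.- + suc c₂) (ℤ.*-identityˡ _) E<C)
              (subst (λ v → + c₁ ℤ.* (+ suc x₂ ℤ.* + suc (e₂ ℕ.* g)) ℤ.≤ (+ x₁ ℤ.* + suc (e₂ ℕ.* g) ℤ.+ v) ℤ.* + suc c₂)
                             (ℤ.*-identityˡ (+ suc x₂)) C≤X+ε)

    below : ∀ e₁ e₂ x₁ x₂ c₁ c₂ g → 0ℤ ℤ.≤ -1ℤ ℤ.* det (e₁ , e₂) (x₁ , suc x₂) →
            + g ℤ.* (-1ℤ ℤ.* det (e₁ , e₂) (c₁ , suc c₂)) ℤ.≤ ℤ.- + suc c₂ →
            ¬ (mkℚᵘ (+ x₁) x₂ Q.- mkℚᵘ 1ℤ (e₂ ℕ.* g) Q.≤ mkℚᵘ (+ c₁) c₂)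
    below e₁ e₂ x₁ x₂ c₁ c₂ g E≤X C<E (Q.*≤* X-ε≤C) =
      no-room (ℤ.- + e₁) (+ e₂) (ℤ.- + x₁) x₂ (ℤ.- + c₁) c₂ (+ g) M (0≤+ e₂) (0≤+ g) (pos-suc-* e₂ g)
              (subst (0ℤ ℤ.≤_) (flip₁ (+ e₁) (+ e₂) (+ x₁) (+ suc x₂)) E≤X)
              (subst (λ v → + g ℤ.* v ℤ.≤ ℤ.- + suc c₂) (flip₁ (+ e₁) (+ e₂) (+ c₁) (+ suc c₂)) C<E)
              (subst₂ ℤ._≤_ (flip₂ (+ c₁) (+ suc x₂) M) (flip₃ (+ x₁) (+ suc x₂) (+ suc c₂) M) (ℤ.neg-mono-≤ X-ε≤C))
      where
      M = + suc (e₂ ℕ.* g)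
      flip₁ : ∀ e₁ e₂ x₁ x₂ → -1ℤ ℤ.* (e₁ ℤ.* x₂ ℤ.- e₂ ℤ.* x₁) ≡ ℤ.- e₁ ℤ.* x₂ ℤ.- e₂ ℤ.* ℤ.- x₁
      flip₁ = ℤ-Solver.solve-∀
      flip₂ : ∀ c₁ x₂ m → ℤ.- (c₁ ℤ.* (x₂ ℤ.* m)) ≡ ℤ.- c₁ ℤ.* (x₂ ℤ.* m)
      flip₂ = ℤ-Solver.solve-∀
      flip₃ : ∀ x₁ x₂ c₂ m → ℤ.- ((x₁ ℤ.* m ℤ.+ -1ℤ ℤ.* x₂) ℤ.* c₂) ≡ (ℤ.- x₁ ℤ.* m ℤ.+ x₂) ℤ.* c₂
      flip₃ = ℤ-Solver.solve-∀

  not-beyond : ∀ E {σ} → IsUnit σ → 0ℤ ℤ.≤ σ ℤ.* det E A → 0ℤ ℤ.≤ σ ℤ.* det E B → ¬ EventuallyBeyond E σ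
  not-beyond (e₁ , e₂) (inj₁ refl) A≤E B≤E (g , K , beyond) with upper (e₂ ℕ.* g)
  ... | K′ , bounded with beyond (K ℕ.+ K′) (ℕ.m≤m+n K K′) | bounded (K ℕ.+ K′) (ℕ.m≤n+m K′ K)
  ... | c₁ , c₂ , C≡ , E<C | C≤max with ⊔-selective (+ r) s (+ t) u
  ...   | inj₁ max≡A = above e₁ e₂ r s c₁ c₂ g A≤E E<C (subst₂ (λ C X → C Q.≤ X Q.+ mkℚᵘ 1ℤ (e₂ ℕ.* g)) C≡ max≡A C≤max)
  ...   | inj₂ max≡B = above e₁ e₂ t u c₁ c₂ g B≤E E<C (subst₂ (λ C X → C Q.≤ X Q.+ mkℚᵘ 1ℤ (e₂ ℕ.* g)) C≡ max≡B C≤max)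
  not-beyond (e₁ , e₂) (inj₂ refl) E≤A E≤B (g , K , beyond) with lower (e₂ ℕ.* g)
  ... | K′ , bounded with beyond (K ℕ.+ K′) (ℕ.m≤m+n K K′) | bounded (K ℕ.+ K′) (ℕ.m≤n+m K′ K)
  ... | c₁ , c₂ , C≡ , C<E | min≤C with ⊓-selective (+ r) s (+ t) u
  ...   | inj₁ min≡A = below e₁ e₂ r s c₁ c₂ g E≤A C<E (subst₂ (λ X C → X Q.- mkℚᵘ 1ℤ (e₂ ℕ.* g) Q.≤ C) min≡A C≡ min≤C)
  ...   | inj₂ min≡B = below e₁ e₂ t u c₁ c₂ g E≤B C<E (subst₂ (λ X C → X Q.- mkℚᵘ 1ℤ (e₂ ℕ.* g) Q.≤ C) min≡B C≡ min≤C)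


negative-margin : ∀ g w d c → c ≤ g ℕ.* w → + g ℤ.* (+ w ℤ.* ℤ.- + suc d) ℤ.≤ ℤ.- + c
negative-margin g w d c c≤gw = subst (ℤ._≤ ℤ.- + c) (sym product) (ℤ.neg-mono-≤ (+≤+ c≤gwd))
  where
  c≤gwd : c ≤ g ℕ.* (w ℕ.* suc d)
  c≤gwd = ℕ.≤-trans c≤gw (ℕ.*-monoʳ-≤ g (ℕ.m≤m*n w (suc d)))
  product : + g ℤ.* (+ w ℤ.* ℤ.- + suc d) ≡ ℤ.- + (g ℕ.* (w ℕ.* suc d))
  product = begin
    + g ℤ.* (+ w ℤ.* ℤ.- + suc d)        ≡⟨ sign (+ g) (+ w) (+ suc d) ⟩
    ℤ.- (+ g ℤ.* (+ w ℤ.* + suc d))      ≡⟨ cong (λ v → ℤ.- (+ g ℤ.* v)) (ℤ.pos-* w (suc d)) ⟨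
    ℤ.- (+ g ℤ.* + (w ℕ.* suc d))        ≡⟨ cong ℤ.-_ (ℤ.pos-* g (w ℕ.* suc d)) ⟨
    ℤ.- + (g ℕ.* (w ℕ.* suc d)) ∎
    where
    open ≡-Reasoning
    sign : ∀ g w d → g ℤ.* (w ℤ.* ℤ.- d) ≡ ℤ.- (g ℤ.* (w ℤ.* d))
    sign = ℤ-Solver.solve-∀

module Descent (α : CF) (valid : ValidCF α) (n r s t u : ℕ)
  (n∣s : suc n ∣ suc s)
  (unimodular : IsUnit (det (r , suc s) (t , suc u)))
  (lower : (mkℚᵘ (+ r) s Q.⊓ mkℚᵘ (+ t) u) ℝ≤ α)
  (upper : α ≤ℝ (mkℚᵘ (+ r) s Q.⊔ mkℚᵘ (+ t) u))
  (loop : InfiniteLoop (suc n) α) where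

  open Separation α r s t u lower upper

  a : ℕ → ℕ
  a = coeffs α

  q-pos : ∀ {k} → InRange α k → 1 ≤ q a k
  q-pos k∈ = q-positive a _ (λ i 1≤i i≤k → coeff-positive α valid 1≤i (inRange-≤ α i≤k k∈))

  -- Frame (j, m) of the descent is the Farey interval with endpoints U j = p_{j-1}/q_{j-1} and
  -- L j m = (m p_{j-1} + p_{j-2})/(m q_{j-1} + q_{j-2}); σ j = ±1 is its orientation.
  U V : ℕ → ℕ²
  U j = pq a (suc j)
  V j = pq a j

  L : ℕ → ℕ → ℕ²
  L j m = comb m (U j) 1 (V j)

  σ : ℕ → ℤ
  σ j = det (U j) (V j)

  σ-unit : ∀ j → IsUnit (σ j)
  σ-unit = det-pq a

  frame-unit : ∀ j m → IsUnit (det (U j) (L j m))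
  frame-unit j m = subst IsUnit (sym (trans (det-combʳ m 1 (U j) (V j)) (ℤ.*-identityˡ (σ j)))) (σ-unit j)

  L-unit : ∀ j m → IsUnit (det (L j (suc m)) (L j m))
  L-unit j m = subst IsUnit (sym (det-comb-succ m (U j) (V j))) (σ-unit j)

  L-last : ∀ {j m} → a j ≡ suc m → L j (suc m) ≡ pq a (suc (suc j))
  L-last {j} a≡ = sym (trans (pq-step a j) (cong (λ c → comb c (U j) 1 (V j)) a≡))

  σ-L-side : ∀ j m x y → σ j ℤ.* det (L j (suc m)) (comb x (L j (suc m)) y (L j m)) ≡ + y
  σ-L-side j m x y =
    trans (cong (σ j ℤ.*_) (trans (det-combʳ x y M (L j m)) (cong (+ y ℤ.*_) (det-comb-succ m (U j) (V j)))))
                           (unit-cancel (σ-unit j) (+ y))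
    where M = L j (suc m)

  σ-L-U : ∀ j m → σ j ℤ.* det (L j (suc m)) (U j) ≡ -1ℤ
  σ-L-U j m = trans (cong (σ j ℤ.*_) (det-combˡ (suc m) 1 (U j) (V j))) (unit-cancel (σ-unit j) -1ℤ)

  dominant-tail : ∀ {j k} → j ≤ k → InRange α k → Dominant (pq a (suc (suc j))) (U j) (pq a (suc (suc k)))
  dominant-tail j≤k k∈ = pq-tail a j≤k (λ e j<e e≤k → coeff-positive α valid (ℕ.≤-trans (s≤s z≤n) j<e) (inRange-≤ α e≤k k∈))

  record Coords (P Q : ℕ²) (x y x′ y′ : ℕ) : Set where
    constructor coords
    field
      A≡ : A ≡ comb x P y Q
      B≡ : B ≡ comb x′ P y′ Q

  coords-unit : ∀ {P Q x y x′ y′} → IsUnit (det P Q) → Coords P Q x y x′ y′ → IsUnit (det (x , y) (x′ , y′))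
  coords-unit {P} {Q} {x} {y} {x′} {y′} unit (coords A≡ B≡) =
    IsUnit-*-cancelʳ unit (subst IsUnit (trans (cong₂ det A≡ B≡) (det-comb x y x′ y′ P Q)) unimodular)

  σ-det-AB : ∀ j m {x y x′ y′} → Coords (L j (suc m)) (L j m) x y x′ y′ → σ j ℤ.* det A B ≡ det (x , y) (x′ , y′)
  σ-det-AB j m {x} {y} {x′} {y′} (coords A≡ B≡) = begin
    σ j ℤ.* det A B                                    ≡⟨ cong (σ j ℤ.*_) (cong₂ det A≡ B≡) ⟩
    σ j ℤ.* det (comb x M y Lm) (comb x′ M y′ Lm)      ≡⟨ cong (σ j ℤ.*_) (det-comb x y x′ y′ M Lm) ⟩
    σ j ℤ.* (δ ℤ.* det M Lm)                           ≡⟨ cong (λ d → σ j ℤ.* (δ ℤ.* d)) (det-comb-succ m (U j) (V j)) ⟩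
    σ j ℤ.* (δ ℤ.* σ j)                                ≡⟨ unit-cancel (σ-unit j) δ ⟩
    δ ∎
    where
    open ≡-Reasoning
    M = L j (suc m)
    Lm = L j m
    δ = det (x , y) (x′ , y′)

  σ-det-self : ∀ j X → 0ℤ ℤ.≤ σ j ℤ.* det X X
  σ-det-self j X = subst (0ℤ ℤ.≤_) (sym (trans (cong (σ j ℤ.*_) (det-self X)) (ℤ.*-zeroʳ (σ j)))) (0≤+ 0)

  next-frame : ∀ {j x y x′ y′} → Coords (U j) (L j (a j)) x y x′ y′ → Coords (U (suc j)) (L (suc j) 0) y x y′ x′
  next-frame {j} {x} {y} {x′} {y′} (coords A≡ B≡) = coords (trans A≡ (swap x y)) (trans B≡ (swap x′ y′))
    where
    swap : ∀ x y → comb x (U j) y (L j (a j)) ≡ comb y (U (suc j)) x (L (suc j) 0)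
    swap x y = begin
      comb x (U j) y (L j (a j))             ≡⟨ cong (comb x (U j) y) (sym (pq-step a j)) ⟩
      comb x (U j) y (U (suc j))             ≡⟨ comb-comm x (U j) y (U (suc j)) ⟩
      comb y (U (suc j)) x (U j)             ≡⟨ cong (comb y (U (suc j)) x) (sym (comb-identityʳ (U (suc j)) (U j))) ⟩
      comb y (U (suc j)) x (L (suc j) 0) ∎
      where open ≡-Reasoning

  A-not-semiconv : ¬ SemiConvDen α (suc s)
  A-not-semiconv A-semiconv = loop (suc s) A-semiconv (λ ()) n∣s

  no-divisible-semiconv : ¬ (∃[ x ] SemiConvDen α x × x ≢ 0 × suc n ∣ x)
  no-divisible-semiconv (x , x-semiconv , x≢0 , n∣x) = loop x x-semiconv x≢0 n∣x

  A≢U : ∀ {j} → InRange α j ⊎ PastEnd α j → A ≢ U j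
  A≢U {zero}  _  A≡U with cong proj₂ A≡U
  ... | ()
  A≢U {suc k} j∈ A≡U = A-not-semiconv (subst (SemiConvDen α) (sym (cong proj₂ A≡U)) (convergentDen α valid k∈))
    where
    k∈ = Data.Sum.[ inRange-≤ α (ℕ.n≤1+n k) , pastEnd-pred α ]′ j∈

  A≢L : ∀ {j m} → Admissible α j m → A ≢ L j m
  A≢L {zero}  {m} _   A≡L = A-not-semiconv (subst (SemiConvDen α) (sym s+1≡1) (convergentDen α valid (inRange-zero α)))
    where
    s+1≡1 : suc s ≡ 1
    s+1≡1 = trans (cong proj₂ A≡L) (cong (ℕ._+ 1) (ℕ.*-zeroʳ m))
  A≢L {suc k} {m} adm A≡L = A-not-semiconv (subst (SemiConvDen α) (sym s+1≡) (semiConvDen α adm))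
    where
    s+1≡ : suc s ≡ m ℕ.* q a k ℕ.+ qPrev a k
    s+1≡ = trans (cong proj₂ A≡L) (cong (m ℕ.* q a k ℕ.+_) (ℕ.*-identityˡ (qPrev a k)))

  A-denominator : ∀ {j m x} → a j ≡ suc m → A ≡ comb x (L j (suc m)) 1 (L j m) → suc s ℕ.+ qPrev a j ≡ suc x ℕ.* q a j
  A-denominator {j} {m} {x} a≡ A≡ = begin
    suc s ℕ.+ qⱼ₋₁                                                       ≡⟨ cong (ℕ._+ qⱼ₋₁) (cong proj₂ A≡) ⟩
    x ℕ.* (suc m ℕ.* qⱼ₋₁ ℕ.+ 1 ℕ.* qⱼ₋₂) ℕ.+ 1 ℕ.* (m ℕ.* qⱼ₋₁ ℕ.+ 1 ℕ.* qⱼ₋₂) ℕ.+ qⱼ₋₁ ≡⟨ collect x m qⱼ₋₁ qⱼ₋₂ ⟩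
    suc x ℕ.* proj₂ (L j (suc m))                                       ≡⟨ cong (λ X → suc x ℕ.* proj₂ X) (L-last a≡) ⟩
    suc x ℕ.* q a j ∎
    where
    open ≡-Reasoning
    qⱼ₋₁ = proj₂ (U j)
    qⱼ₋₂ = proj₂ (V j)
    collect : ∀ x m u v → x ℕ.* (suc m ℕ.* u ℕ.+ 1 ℕ.* v) ℕ.+ 1 ℕ.* (m ℕ.* u ℕ.+ 1 ℕ.* v) ℕ.+ u
                        ≡ suc x ℕ.* (suc m ℕ.* u ℕ.+ 1 ℕ.* v)
    collect = ℕ-Solver.solve-∀

  RecedesAt : ℕ² → ℕ² → ℕ → Set
  RecedesAt E P i = ∃[ k ] InRange α k × conv α i ≡ convAt a k ×
                    ∃[ λ′ ] ∃[ w ] pq a (suc (suc k)) ≡ comb λ′ E w P × λ′ ≤ w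

  Receding : ℕ² → ℕ² → Set
  Receding E P = ∃[ K ] ∀ i → K ≤ i → RecedesAt E P i

  beyond : ∀ E P {ε} d → ε ℤ.* det E P ≡ ℤ.- + suc d → Receding E P → EventuallyBeyond E ε
  beyond E P {ε} d εEP≡ (K , receding) = g , K , convergent
    where
    g = proj₂ E ℕ.+ proj₂ P
    convergent : ∀ i → K ≤ i → ∃[ c₁ ] ∃[ c₂ ]
                 conv α i ≡ mkℚᵘ (+ c₁) c₂ × + g ℤ.* (ε ℤ.* det E (c₁ , suc c₂)) ℤ.≤ ℤ.- + suc c₂
    convergent i K≤i with receding i K≤i
    ... | k , k∈ , conv≡ , λ′ , w , C≡ , λ′≤w =
      p a k , q a k ℕ.∸ 1 , conv≡ ,
      subst (λ c₂ → + g ℤ.* (ε ℤ.* det E (p a k , c₂)) ℤ.≤ ℤ.- + c₂) (sym (ℕ.suc-pred (q a k) {{ℕ.>-nonZero (q-pos k∈)}})) margin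
      where
      εEC≡ : ε ℤ.* det E (p a k , q a k) ≡ + w ℤ.* ℤ.- + suc d
      εEC≡ = begin
        ε ℤ.* det E (p a k , q a k)      ≡⟨ cong (λ C → ε ℤ.* det E C) C≡ ⟩
        ε ℤ.* det E (comb λ′ E w P)      ≡⟨ cong (ε ℤ.*_) (det-combʳ λ′ w E P) ⟩
        ε ℤ.* (+ w ℤ.* det E P)          ≡⟨ ℤ.*-assoc ε (+ w) (det E P) ⟨
        ε ℤ.* + w ℤ.* det E P            ≡⟨ cong (ℤ._* det E P) (ℤ.*-comm ε (+ w)) ⟩
        + w ℤ.* ε ℤ.* det E P            ≡⟨ ℤ.*-assoc (+ w) ε (det E P) ⟩
        + w ℤ.* (ε ℤ.* det E P)          ≡⟨ cong (+ w ℤ.*_) εEP≡ ⟩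
        + w ℤ.* ℤ.- + suc d ∎
        where open ≡-Reasoning
      margin : + g ℤ.* (ε ℤ.* det E (p a k , q a k)) ℤ.≤ ℤ.- + q a k
      margin = subst (λ v → + g ℤ.* v ℤ.≤ ℤ.- + q a k) (sym εEC≡)
                 (negative-margin g w d (q a k) (subst (ℕ._≤ g ℕ.* w) (sym (cong proj₂ C≡))
                                                       (comb-denominator-≤ λ′ w w E P λ′≤w ℕ.≤-refl)))

  behind : ∀ j m {x y x′ y′} P → Coords (L j (suc m)) (L j m) x y x′ y′ →
           σ j ℤ.* det (L j (suc m)) P ≡ -1ℤ → Receding (L j (suc m)) P → ⊥
  behind j m {x} {y} {x′} {y′} P (coords A≡ B≡) σMP≡ receding =
    not-beyond (L j (suc m)) (σ-unit j) (side A≡ (σ-L-side j m x y)) (side B≡ (σ-L-side j m x′ y′))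
               (beyond _ P {σ j} 0 σMP≡ receding)
    where
    side : ∀ {X Y k} → X ≡ Y → σ j ℤ.* det (L j (suc m)) Y ≡ + k → 0ℤ ℤ.≤ σ j ℤ.* det (L j (suc m)) X
    side {k = k} refl eq = subst (0ℤ ℤ.≤_) (sym eq) (0≤+ k)

  behind-endpoint : ∀ {j m} → a j ≡ suc m → PastEnd α (suc j) →
                    ∀ {X x₀ y₀} → X ≡ comb x₀ (L j (suc m)) (suc y₀) (L j m) →
                    0ℤ ℤ.≤ σ j ℤ.* det X A → 0ℤ ℤ.≤ σ j ℤ.* det X B → ⊥
  behind-endpoint {j} {m} a≡ end {X} {x₀} {y₀} X≡ XA XB =
    not-beyond X (σ-unit j) XA XB (beyond X M {σ j} y₀ σXM≡ (j , constant))
    where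
    M = L j (suc m)
    σXM≡ : σ j ℤ.* det X M ≡ ℤ.- + suc y₀
    σXM≡ = begin
      σ j ℤ.* det X M                                   ≡⟨ cong (λ Y → σ j ℤ.* det Y M) X≡ ⟩
      σ j ℤ.* det (comb x₀ M (suc y₀) (L j m)) M        ≡⟨ cong (σ j ℤ.*_) (det-combˡ x₀ (suc y₀) M (L j m)) ⟩
      σ j ℤ.* (ℤ.- + suc y₀ ℤ.* det M (L j m))          ≡⟨ cong (λ d → σ j ℤ.* (ℤ.- + suc y₀ ℤ.* d)) (det-comb-succ m (U j) (V j)) ⟩
      σ j ℤ.* (ℤ.- + suc y₀ ℤ.* σ j)                    ≡⟨ unit-cancel (σ-unit j) (ℤ.- + suc y₀) ⟩
      ℤ.- + suc y₀ ∎
      where open ≡-Reasoning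
    constant : ∀ i → j ≤ i → RecedesAt X M i
    constant i j≤i = j , pastEnd-pred α end , conv-pastEnd α end i j≤i , 0 , 1 ,
                     trans (sym (L-last a≡)) (sym (comb-identityʳ X M)) , z≤n

  -- Here α = U (suc k).
  escape-past-end : ∀ {k m x y x′ y′} → PastEnd α (suc k) → Coords (L (suc k) (suc m)) (L (suc k) m) x y x′ y′ → ⊥
  escape-past-end {k} {m} end frame = behind (suc k) m (U (suc k)) frame (σ-L-U (suc k) m) (k , constant)
    where
    constant : ∀ i → k ≤ i → RecedesAt (L (suc k) (suc m)) (U (suc k)) i
    constant i k≤i = k , pastEnd-pred α end , conv-pastEnd α end i k≤i , 0 , 1 ,
                     sym (comb-identityʳ (L (suc k) (suc m)) (U (suc k))) , z≤n

  escape-inside : ∀ {j m e x y x′ y′} → InRange α j → a j ≡ suc e ℕ.+ suc m →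
                  Coords (L j (suc m)) (L j m) x y x′ y′ → ⊥
  escape-inside {j} {m} {e} j∈ a≡ frame with conv-tail α j∈
  ... | K , tail = behind j m (U j) frame (σ-L-U j m) (K , receding)
    where
    W≡ : pq a (suc (suc j)) ≡ comb 1 (L j (suc m)) (suc e) (U j)
    W≡ = trans (pq-step a j) (trans (cong (λ c → comb c (U j) 1 (V j)) a≡) (comb-split (suc e) (suc m) (U j) (V j)))
    receding : ∀ i → K ≤ i → RecedesAt (L j (suc m)) (U j) i
    receding i K≤i with tail i K≤i
    ... | k , j≤k , k∈ , conv≡ with dominant-tail j≤k k∈
    ... | μ , ν , C≡ , _ , _ =
      k , k∈ , conv≡ , μ , μ ℕ.* suc e ℕ.+ ν ,
      trans C≡ (trans (cong (λ W → comb μ W ν (U j)) W≡) (comb-absorb μ (suc e) ν _ _)) ,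
      ℕ.≤-trans (ℕ.m≤m*n μ (suc e)) (ℕ.m≤m+n _ ν)

  escape-at-convergent : ∀ {j m x y x′ y′} → InRange α (suc j) → a j ≡ suc m →
                         Coords (L j (suc m)) (L j m) x y x′ y′ → ⊥
  escape-at-convergent {j} {m} sj∈ a≡ frame with conv-tail α sj∈
  ... | K , tail = behind j m W′ frame σMW′≡ (K , receding)
    where
    W W′ : ℕ²
    W = pq a (suc (suc j))
    W′ = pq a (suc (suc (suc j)))
    W≡M : W ≡ L j (suc m)
    W≡M = trans (pq-step a j) (cong (λ c → comb c (U j) 1 (V j)) a≡)
    σMW′≡ : σ j ℤ.* det (L j (suc m)) W′ ≡ -1ℤ
    σMW′≡ = begin
      σ j ℤ.* det (L j (suc m)) W′      ≡⟨ cong (λ X → σ j ℤ.* det X W′) W≡M ⟨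
      σ j ℤ.* det W W′                  ≡⟨ cong (σ j ℤ.*_) (det-antisym W W′) ⟩
      σ j ℤ.* ℤ.- det W′ W              ≡⟨ cong (λ d → σ j ℤ.* ℤ.- d) (det-pq-step a (suc j)) ⟩
      σ j ℤ.* ℤ.- ℤ.- det W (U j)       ≡⟨ cong (σ j ℤ.*_) (ℤ.neg-involutive (det W (U j))) ⟩
      σ j ℤ.* det W (U j)               ≡⟨ cong (σ j ℤ.*_) (det-pq-step a j) ⟩
      σ j ℤ.* ℤ.- σ j                   ≡⟨ cong (σ j ℤ.*_) (ℤ.-1*i≡-i (σ j)) ⟨
      σ j ℤ.* (-1ℤ ℤ.* σ j)             ≡⟨ unit-cancel (σ-unit j) -1ℤ ⟩
      -1ℤ ∎
      where open ≡-Reasoning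
    receding : ∀ i → K ≤ i → RecedesAt (L j (suc m)) W′ i
    receding i K≤i with tail i K≤i
    ... | k , sj≤k , k∈ , conv≡ with dominant-tail sj≤k k∈
    ... | μ , ν , C≡ , _ , ν≤μ =
      k , k∈ , conv≡ , ν , μ , trans C≡ (trans (comb-comm μ W′ ν W) (cong (λ X → comb ν X μ W′) W≡M)) , ν≤μ

  -- In the three at-end lemmas α is the rational L j (suc m).
  at-end-first : ∀ {j m x x′ y′} → InRange α j → a j ≡ suc m →
                 Coords (L j (suc m)) (L j m) x 0 x′ y′ → ⊥
  at-end-first {j} {m} {x} {x′} {y′} j∈ a≡ frame@(coords A≡ _) =
    A-not-semiconv (subst (SemiConvDen α) (sym (cong proj₂ A≡W)) (convergentDen α valid j∈))
    where
    A≡W : A ≡ pq a (suc (suc j))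
    A≡W = begin
      A                                ≡⟨ A≡ ⟩
      comb x (L j (suc m)) 0 (L j m)   ≡⟨ cong (λ c → comb c (L j (suc m)) 0 (L j m))
                                               (unit-first-row x x′ y′ (coords-unit (L-unit j m) frame)) ⟩
      comb 1 (L j (suc m)) 0 (L j m)   ≡⟨ comb-identityˡ (L j (suc m)) (L j m) ⟩
      L j (suc m)                      ≡⟨ L-last a≡ ⟩
      pq a (suc (suc j)) ∎
      where open ≡-Reasoning

  at-end-second : ∀ {j m x y x′} → InRange α j → a j ≡ suc m → PastEnd α (suc j) →
                  Coords (L j (suc m)) (L j m) x (suc y) x′ 0 → ⊥
  at-end-second {j} {m} {x} {y} {x′} j∈ a≡ end frame@(coords A≡ _) =
    no-divisible-semiconv (divisible-at-end α {j} end (q-pos j∈) n {suc s} {suc x} (A-denominator {j} {m} {x} a≡ A≡′) n∣s)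
    where
    A≡′ : A ≡ comb x (L j (suc m)) 1 (L j m)
    A≡′ = trans A≡ (cong (λ k → comb x (L j (suc m)) k (L j m))
                         (unit-second-row x (suc y) x′ (coords-unit (L-unit j m) frame)))

  at-end-interior : ∀ {j m x y x′ y′} → a j ≡ suc m → PastEnd α (suc j) →
                    Coords (L j (suc m)) (L j m) x (suc y) x′ (suc y′) → ⊥
  at-end-interior {j} {m} {x} {y} {x′} {y′} a≡ end frame@(coords A≡ B≡) =
    Data.Sum.[ A-nearer , B-nearer ]′ (coords-unit (L-unit j m) frame)
    where
    δ = det (x , suc y) (x′ , suc y′)
    A-nearer : δ ≡ 1ℤ → ⊥
    A-nearer δ≡1 = behind-endpoint {j} {m} a≡ end {A} {x} {y} A≡ (σ-det-self j A)
                     (subst (0ℤ ℤ.≤_) (sym (trans (σ-det-AB j m frame) δ≡1)) (0≤+ 1))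
    B-nearer : δ ≡ -1ℤ → ⊥
    B-nearer δ≡-1 = behind-endpoint {j} {m} a≡ end {B} {x′} {y′} B≡ (subst (0ℤ ℤ.≤_) (sym σBA≡1) (0≤+ 1)) (σ-det-self j B)
      where
      σBA≡1 : σ j ℤ.* det B A ≡ 1ℤ
      σBA≡1 = begin
        σ j ℤ.* det B A          ≡⟨ cong (σ j ℤ.*_) (det-antisym B A) ⟩
        σ j ℤ.* ℤ.- det A B      ≡⟨ ℤ.neg-distribʳ-* (σ j) (det A B) ⟨
        ℤ.- (σ j ℤ.* det A B)    ≡⟨ cong ℤ.-_ (trans (σ-det-AB j m frame) δ≡-1) ⟩
        1ℤ ∎
        where open ≡-Reasoning

  escape-at-end : ∀ {j m x y x′ y′} → InRange α j → a j ≡ suc m → PastEnd α (suc j) →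
                  Coords (L j (suc m)) (L j m) x y x′ y′ → ⊥
  escape-at-end {j} {m} {y = zero}              j∈ a≡ end frame = at-end-first {j} {m} j∈ a≡ frame
  escape-at-end {j} {m} {y = suc _} {y′ = zero}  j∈ a≡ end frame = at-end-second {j} {m} j∈ a≡ end frame
  escape-at-end {j} {m} {y = suc _} {y′ = suc _} j∈ a≡ end frame = at-end-interior {j} {m} a≡ end frame

  escape : ∀ {j m x y x′ y′} → Admissible α j (suc m) → Coords (L j (suc m)) (L j m) x y x′ y′ → ⊥
  escape {zero}  (inj₂ end) frame = inRange-pastEnd α (inRange-zero α) end
  escape {suc k} {m} (inj₂ end) frame = escape-past-end {k} {m} end frame
  escape {j} {m} (inj₁ (j∈ , m<a)) frame with ℕ.m≤n⇒m<n∨m≡n m<a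
  ... | inj₁ m+1<a with offset m+1<a
  ...   | e , a≡ = escape-inside {j} {m} j∈ (trans a≡ (ℕ.+-suc e (suc m))) frame
  escape {j} {m} (inj₁ (j∈ , m<a)) frame | inj₂ m+1≡a with inRange-suc α j∈
  ...   | inj₁ sj∈ = escape-at-convergent {j} {m} sj∈ (sym m+1≡a) frame
  ...   | inj₂ end = escape-at-end {j} {m} j∈ (sym m+1≡a) end frame

  -- The fuel bounds x + y + x′ + y′, which each refinement lowers and a change of frame permutes.
  mutual
    descend : ∀ fuel j m {x y x′ y′} → Admissible α j m → Coords (U j) (L j m) x y x′ y′ →
              x ℕ.+ y ℕ.+ x′ ℕ.+ y′ < fuel → ⊥
    descend fuel j m (inj₂ end)         = step fuel j m (inj₂ end)
    descend fuel j m (inj₁ (j∈ , m≤a)) = descend-in-range fuel j m j∈ (ℕ.m≤n⇒m<n∨m≡n m≤a)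

    descend-in-range : ∀ fuel j m {x y x′ y′} → InRange α j → m < a j ⊎ m ≡ a j → Coords (U j) (L j m) x y x′ y′ →
                       x ℕ.+ y ℕ.+ x′ ℕ.+ y′ < fuel → ⊥
    descend-in-range fuel j m j∈ (inj₁ m<a) = step fuel j m (inj₁ (j∈ , m<a))
    descend-in-range fuel j m {x} {y} {x′} {y′} j∈ (inj₂ refl) frame size< =
      step fuel (suc j) 0 {y} {x} {y′} {x′} (admissible-start α valid j∈) (next-frame frame)
           (subst (_< fuel) (reorder x y x′ y′) size<)
      where
      reorder : ∀ x y x′ y′ → x ℕ.+ y ℕ.+ x′ ℕ.+ y′ ≡ y ℕ.+ x ℕ.+ y′ ℕ.+ x′
      reorder = ℕ-Solver.solve-∀

    step : ∀ fuel j m {x y x′ y′} → Admissible α j (suc m) → Coords (U j) (L j m) x y x′ y′ →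
           x ℕ.+ y ℕ.+ x′ ℕ.+ y′ < fuel → ⊥
    step (suc fuel) j m {x} {y} {x′} {y′} adm frame (s≤s size≤) =
      step-by-shape fuel j m adm frame size≤ (unimodular-shape x y x′ y′ (coords-unit (frame-unit j m) frame))

    step-by-shape : ∀ fuel j m {x y x′ y′} → Admissible α j (suc m) → Coords (U j) (L j m) x y x′ y′ →
                    x ℕ.+ y ℕ.+ x′ ℕ.+ y′ ≤ fuel → UnimodularShape x y x′ y′ → ⊥
    step-by-shape fuel j m adm frame@(coords A≡ B≡) size≤ (first-dominates k y k′ y′) =
      descend fuel j (suc m) {k} {y} {k′} {y′} adm
        (coords (trans A≡ (comb-shiftˡ k y m (U j) (V j))) (trans B≡ (comb-shiftˡ k′ y′ m (U j) (V j))))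
        (ℕ.<-≤-trans (shrinks (unit-second-column (k ℕ.+ y) y (k′ ℕ.+ y′) y′ (coords-unit (frame-unit j m) frame))) size≤)
      where
      shrinks : 1 ≤ y ℕ.+ y′ → k ℕ.+ y ℕ.+ k′ ℕ.+ y′ < k ℕ.+ y ℕ.+ y ℕ.+ (k′ ℕ.+ y′) ℕ.+ y′
      shrinks 1≤y+y′ = subst (k ℕ.+ y ℕ.+ k′ ℕ.+ y′ <_) (regroup k y k′ y′) (ℕ.m<m+n _ 1≤y+y′)
        where
        regroup : ∀ k y k′ y′ → k ℕ.+ y ℕ.+ k′ ℕ.+ y′ ℕ.+ (y ℕ.+ y′) ≡ k ℕ.+ y ℕ.+ y ℕ.+ (k′ ℕ.+ y′) ℕ.+ y′
        regroup = ℕ-Solver.solve-∀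
    step-by-shape fuel j m adm (coords A≡ B≡) _ (second-dominates x k x′ k′) =
      escape {x = x} {k} {x′} {k′} adm
        (coords (trans A≡ (comb-shiftʳ x k m (U j) (V j))) (trans B≡ (comb-shiftʳ x′ k′ m (U j) (V j))))
    step-by-shape fuel j m adm (coords A≡ _) _ standard =
      A≢U (Data.Sum.map₁ proj₁ adm) (trans A≡ (comb-identityˡ (U j) (L j m)))
    step-by-shape fuel j m adm (coords A≡ _) _ swapped  =
      A≢L (admissible-pred α adm) (trans A≡ (comb-identityʳ (U j) (L j m)))

  contradiction : ⊥
  contradiction = descend (suc (r ℕ.+ suc s ℕ.+ t ℕ.+ suc u)) 0 0 {r} {suc s} {t} {suc u} (inj₁ (inRange-zero α , z≤n))
                    (coords (sym (comb-standard r (suc s))) (sym (comb-standard t (suc u)))) ℕ.≤-refl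

data Representation : ℤ → ℤ → ℕ → ℕ → Set where
  positive : ∀ r s → Representation (+ r) (+ suc s) r s
  negative : ∀ r s → Representation (ℤ.- + r) (ℤ.- + suc s) r s

positive-fraction : ∀ x y → y ≢ 0ℤ → 0ℚᵘ Q.< frac x y →
                    ∃[ r ] ∃[ s ] frac x y ≡ mkℚᵘ (+ r) s × Representation x y r s
positive-fraction x         (+ zero)  y≢0 _ = ⊥-elim (y≢0 refl)
positive-fraction (+ suc r) (+ suc s) _   _ = suc r , s , refl , positive (suc r) s
positive-fraction -[1+ r ]  -[1+ s ]  _   _ = suc r , s , refl , negative (suc r) s
positive-fraction (+ zero)  (+ suc s) _   (Q.*<* (ℤ.+<+ ()))
positive-fraction -[1+ r ]  (+ suc s) _   (Q.*<* ())
positive-fraction (+ zero)  -[1+ s ]  _   (Q.*<* (ℤ.+<+ ()))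
positive-fraction (+ suc r) -[1+ s ]  _   (Q.*<* ())

representation-denominator : ∀ {x y r s} → Representation x y r s → ℤ.∣ y ∣ ≡ suc s
representation-denominator (positive r s) = refl
representation-denominator (negative r s) = refl

representation-det : ∀ {a b c d r s t u} → Representation a c r s → Representation b d t u →
                     IsUnit (a ℤ.* d ℤ.- b ℤ.* c) → IsUnit (det (r , suc s) (t , suc u))
representation-det (positive r s) (positive t u) unit = subst IsUnit (rearrange (+ r) (+ suc s) (+ t) (+ suc u)) unit
  where
  rearrange : ∀ r s t u → r ℤ.* u ℤ.- t ℤ.* s ≡ r ℤ.* u ℤ.- s ℤ.* t
  rearrange = ℤ-Solver.solve-∀
representation-det (negative r s) (negative t u) unit = subst IsUnit (rearrange (+ r) (+ suc s) (+ t) (+ suc u)) unit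
  where
  rearrange : ∀ r s t u → ℤ.- r ℤ.* ℤ.- u ℤ.- ℤ.- t ℤ.* ℤ.- s ≡ r ℤ.* u ℤ.- s ℤ.* t
  rearrange = ℤ-Solver.solve-∀
representation-det (positive r s) (negative t u) unit =
  subst IsUnit (rearrange (+ r) (+ suc s) (+ t) (+ suc u)) (IsUnit-neg unit)
  where
  rearrange : ∀ r s t u → ℤ.- (r ℤ.* ℤ.- u ℤ.- ℤ.- t ℤ.* s) ≡ r ℤ.* u ℤ.- s ℤ.* t
  rearrange = ℤ-Solver.solve-∀
representation-det (negative r s) (positive t u) unit =
  subst IsUnit (rearrange (+ r) (+ suc s) (+ t) (+ suc u)) (IsUnit-neg unit)
  where
  rearrange : ∀ r s t u → ℤ.- (ℤ.- r ℤ.* u ℤ.- t ℤ.* ℤ.- s) ≡ r ℤ.* u ℤ.- s ℤ.* t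
  rearrange = ℤ-Solver.solve-∀

∣z∣≡1⇒IsUnit : ∀ z → ℤ.∣ z ∣ ≡ 1 → IsUnit z
∣z∣≡1⇒IsUnit (+ 1)    _ = inj₁ refl
∣z∣≡1⇒IsUnit -[1+ 0 ] _ = inj₂ refl
∣z∣≡1⇒IsUnit (+ 0)            ()
∣z∣≡1⇒IsUnit (+ suc (suc _))  ()
∣z∣≡1⇒IsUnit -[1+ suc _ ]     ()

mainTheorem7 : (n : ℕ) (a b c d : ℤ) →
    c ℤ.* + n ≢ + 0 → d ≢ + 0 →
    0ℚᵘ Q.< frac a (c ℤ.* + n) → 0ℚᵘ Q.< frac b d →
    ℤ.∣ a ℤ.* d ℤ.- b ℤ.* c ℤ.* + n ∣ ≡ 1 →
    (α : CF) → ValidCF α → PositiveCF α →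
    (frac a (c ℤ.* + n) Q.⊓ frac b d) ℝ≤ α → α ≤ℝ (frac a (c ℤ.* + n) Q.⊔ frac b d) →
    ¬ InfiniteLoop n α
mainTheorem7 zero    a b c d cn≢0 _ _ _ _ _ _ _ _ _ _ = cn≢0 (ℤ.*-zeroʳ c)
-- Positivity of α is implied by the lower bound.
mainTheorem7 (suc n) a b c d cn≢0 d≢0 A>0 B>0 ∣det∣≡1 α valid _ lower upper loop
  with positive-fraction a (c ℤ.* + suc n) cn≢0 A>0 | positive-fraction b d d≢0 B>0
... | r , s , A≡ , repA | t , u , B≡ , repB =
  Descent.contradiction α valid n r s t u n∣s unimodular
    (subst₂ (λ X Y → (X Q.⊓ Y) ℝ≤ α) A≡ B≡ lower) (subst₂ (λ X Y → α ≤ℝ (X Q.⊔ Y)) A≡ B≡ upper) loop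
  where
  n∣s : suc n ∣ suc s
  n∣s = divides ℤ.∣ c ∣ (trans (sym (representation-denominator repA)) (ℤ.abs-* c (+ suc n)))
  unimodular : IsUnit (det (r , suc s) (t , suc u))
  unimodular = representation-det repA repB
    (∣z∣≡1⇒IsUnit _ (trans (cong (λ z → ℤ.∣ a ℤ.* d ℤ.- z ∣) (sym (ℤ.*-assoc b c (+ suc n)))) ∣det∣≡1))
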